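{- If $M'$ is a conflict-free row split of a binary matrix $M$, then the number of distinct columns of $M'$ is at least the number of distinct columns of $M$.
   Context: Binary matrices have no all-zero rows. A row split of $M$ (rows $r_1,\dots,r_m$, $n$ columns) is a binary matrix $M'$ with $n$ columns whose rows can be partitioned into $R_1,\dots,R_m$ with $r_i$ the bitwise OR of the rows in $R_i$; column $j$ of $M'$ corresponds to column $j$ of $M$. Conflict-free: no two columns $i,j$ and three distinct rows $r,r',r''$ with $(M_{r,i},M_{r,j})=(1,1),(M_{r',i},M_{r',j})=(1,0),(M_{r'',i},M_{r'',j})=(0,1)$. -}

module Defs where

open import Data.Bool using (Bool; true; false)
open import Data.Bool.Properties using () renaming (_≟_ to _≟ᵇ_)
open import Data.Fin using (Fin)
open import Data.Nat using (ℕ)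
open import Data.List using (List; length; map; deduplicate; allFin)
open import Data.Vec using (Vec; tabulate)
open import Data.Vec.Properties using (≡-dec)
open import Data.Product using (Σ; ∃; ∃-syntax; _×_)
open import Relation.Binary.PropositionalEquality using (_≡_; _≢_)
open import Relation.Nullary using (¬_)

Matrix : ℕ → ℕ → Set
Matrix m n = Fin m → Fin n → Bool

-- Binary matrix: no all-zero rows.
IsBinary : ∀ {m n} → Matrix m n → Set
IsBinary {m} {n} M = ∀ (r : Fin m) → ∃[ j ] M r j ≡ true

-- M' (m' rows) is a row split of M (m rows) : M' is binary and there is a
-- partition of the rows of M' into classes R_1..R_m, given by the map
-- f : row of M' ↦ index of its class, such that row i of M is the bitwise OR
-- of the rows of M' in class R_i.  (Each class is automatically nonempty
-- since the rows of M are nonzero.)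
IsRowSplitVia : ∀ {m m' n} → Matrix m n → Matrix m' n → (Fin m' → Fin m) → Set
IsRowSplitVia {m} {m'} {n} M M' f =
  ∀ (i : Fin m) (j : Fin n) →
    (M i j ≡ true → ∃[ r ] (f r ≡ i × M' r j ≡ true)) ×
    (∀ (r : Fin m') → f r ≡ i → M' r j ≡ true → M i j ≡ true)

IsRowSplit : ∀ {m m' n} → Matrix m n → Matrix m' n → Set
IsRowSplit {m} {m'} M M' =
  IsBinary M' × ∃[ f ] IsRowSplitVia {m} {m'} M M' f

ConflictFree : ∀ {m n} → Matrix m n → Set
ConflictFree {m} {n} M =
  ¬ (Σ (Fin n) λ i → Σ (Fin n) λ j → Σ (Fin m) λ r → Σ (Fin m) λ r' → Σ (Fin m) λ r'' →
       (r ≢ r') × (r ≢ r'') × (r' ≢ r'') ×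
       (M r i ≡ true × M r j ≡ true) ×
       (M r' i ≡ true × M r' j ≡ false) ×
       (M r'' i ≡ false × M r'' j ≡ true))

column : ∀ {m n} → Matrix m n → Fin n → Vec Bool m
column M j = tabulate (λ r → M r j)

distinctColumns : ∀ {m n} → Matrix m n → ℕ
distinctColumns {m} {n} M =
  length (deduplicate (≡-dec _≟ᵇ_) (map (column M) (allFin n)))

-- Each column of M arises from the corresponding column of M' by OR-ing the
-- entries inside every row class, so the columns of M are the image of the
-- columns of M' under one fixed map, and a map cannot increase the number of
-- distinct values.
module Submission where

open import Defs
open import Data.Bool using (Bool; true)
open import Data.Bool.Properties using (T-≡) renaming (_≟_ to _≟ᵇ_)
open import Data.Fin using (Fin)
open import Data.Fin.Properties using (any?) renaming (_≟_ to _≟ᶠ_)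
open import Data.List using (List; []; _∷_; length; map; filter; deduplicate; allFin)
open import Data.List.Properties using (length-map; map-cong; map-∘; filter-notAll)
open import Data.List.Relation.Unary.Any as Any using (here; there)
open import Data.List.Relation.Unary.All using (lookup)
open import Data.List.Relation.Unary.AllPairs using (_∷_)
open import Data.List.Relation.Unary.Unique.Propositional using (Unique)
open import Data.List.Relation.Unary.Unique.DecPropositional.Properties using (deduplicate-!)
open import Data.List.Relation.Binary.Subset.Propositional using (_⊆_)
open import Data.List.Membership.Propositional.Properties
  using (∈-map⁺; ∈-map⁻; ∈-filter⁺; ∈-deduplicate⁺; ∈-deduplicate⁻)
open import Data.Nat using (ℕ; _≤_; z≤n; s≤s)
open import Data.Nat.Properties using (≤-trans; ≤-reflexive; module ≤-Reasoning)
open import Data.Product using (∃; _×_; _,_; proj₁; proj₂)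
open import Data.Vec using (Vec; tabulate) renaming (lookup to lookupᵥ)
open import Data.Vec.Properties using (≡-dec; lookup∘tabulate; tabulate-cong)
open import Function using (_∘_; Equivalence)
open import Relation.Binary.Definitions using (DecidableEquality)
open import Relation.Binary.PropositionalEquality using (_≡_; refl; sym; trans; cong)
open import Relation.Nullary using (Dec; does; proof; ¬?)
open import Relation.Nullary.Decidable using (_×-dec_)
open import Relation.Nullary.Reflects using (det; fromEquivalence)

module _ {a} {A : Set a} (_≟_ : DecidableEquality A) where

  Unique-⊆⇒length≤ : {us vs : List A} → Unique us → us ⊆ vs → length us ≤ length vs
  Unique-⊆⇒length≤ {[]}     _            _      = z≤n
  Unique-⊆⇒length≤ {u ∷ us} {vs} (u∉us ∷ uniq) us⊆vs =
    ≤-trans (s≤s (Unique-⊆⇒length≤ uniq us⊆vs∖u))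
            (filter-notAll (¬? ∘ (u ≟_)) vs (Any.map (λ u≡v u≢v → u≢v u≡v) (us⊆vs (here refl))))
    where
    us⊆vs∖u : us ⊆ filter (¬? ∘ (u ≟_)) vs
    us⊆vs∖u w∈us = ∈-filter⁺ (¬? ∘ (u ≟_)) (us⊆vs (there w∈us)) (lookup u∉us w∈us)

length-deduplicate-map≤ : ∀ {a b} {A : Set a} {B : Set b}
  (_≟ᴬ_ : DecidableEquality A) (_≟ᴮ_ : DecidableEquality B) (g : A → B) (xs : List A) →
  length (deduplicate _≟ᴮ_ (map g xs)) ≤ length (deduplicate _≟ᴬ_ xs)
length-deduplicate-map≤ _≟ᴬ_ _≟ᴮ_ g xs =
  ≤-trans (Unique-⊆⇒length≤ _≟ᴮ_ (deduplicate-! _≟ᴮ_ (map g xs)) image⊆)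
          (≤-reflexive (length-map g (deduplicate _≟ᴬ_ xs)))
  where
  image⊆ : deduplicate _≟ᴮ_ (map g xs) ⊆ map g (deduplicate _≟ᴬ_ xs)
  image⊆ y∈ with x , x∈xs , refl ← ∈-map⁻ g (∈-deduplicate⁻ _≟ᴮ_ (map g xs) y∈) =
    ∈-map⁺ g (∈-deduplicate⁺ _≟ᴬ_ x∈xs)

≡-does : ∀ {p} {P : Set p} {b : Bool} → (b ≡ true → P) → (P → b ≡ true) →
         (P? : Dec P) → b ≡ does P?
≡-does b⇒P P⇒b P? =
  det (fromEquivalence (b⇒P ∘ Equivalence.to T-≡) (Equivalence.from T-≡ ∘ P⇒b)) (proof P?)

classHasOne? : ∀ {m m'} (f : Fin m' → Fin m) (v : Vec Bool m') (i : Fin m) →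
               Dec (∃ λ r → f r ≡ i × lookupᵥ v r ≡ true)
classHasOne? f v i = any? λ r → (f r ≟ᶠ i) ×-dec (lookupᵥ v r ≟ᵇ true)

mergeRows : ∀ {m m'} → (Fin m' → Fin m) → Vec Bool m' → Vec Bool m
mergeRows f v = tabulate λ i → does (classHasOne? f v i)

column-mergeRows : ∀ {m m' n} {M : Matrix m n} {M' : Matrix m' n} {f : Fin m' → Fin m} →
  IsRowSplitVia M M' f → ∀ j → column M j ≡ mergeRows f (column M' j)
column-mergeRows {M = M} {M'} {f} split j =
  tabulate-cong λ i → ≡-does (inClass i) (fromClass i) (classHasOne? f (column M' j) i)
  where
  inClass : ∀ i → M i j ≡ true → ∃ λ r → f r ≡ i × lookupᵥ (column M' j) r ≡ true
  inClass i Mij with r , fr≡i , M'rj ← proj₁ (split i j) Mij =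
    r , fr≡i , trans (lookup∘tabulate (λ r → M' r j) r) M'rj

  fromClass : ∀ i → (∃ λ r → f r ≡ i × lookupᵥ (column M' j) r ≡ true) → M i j ≡ true
  fromClass i (r , fr≡i , M'rj) =
    proj₂ (split i j) r fr≡i (trans (sym (lookup∘tabulate (λ r → M' r j) r)) M'rj)

lemma4 : ∀ {m m' n : ℕ} (M : Matrix m n) (M' : Matrix m' n) →
    IsBinary M → IsRowSplit M M' → ConflictFree M' →
    distinctColumns M ≤ distinctColumns M'
lemma4 {m} {m'} {n} M M' _ (_ , f , split) _ = begin
  distinctColumns M
    ≡⟨ cong (length ∘ deduplicate (≡-dec _≟ᵇ_)) (map-cong (column-mergeRows split) (allFin n)) ⟩
  length (deduplicate (≡-dec _≟ᵇ_) (map (mergeRows f ∘ column M') (allFin n)))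
    ≡⟨ cong (length ∘ deduplicate (≡-dec _≟ᵇ_)) (map-∘ (allFin n)) ⟩
  length (deduplicate (≡-dec _≟ᵇ_) (map (mergeRows f) (map (column M') (allFin n))))
    ≤⟨ length-deduplicate-map≤ (≡-dec _≟ᵇ_) (≡-dec _≟ᵇ_) (mergeRows f) (map (column M') (allFin n)) ⟩
  distinctColumns M' ∎
  where open ≤-Reasoning
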